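{- Let $(S,d)$ be a $k$-center instance (with possibly asymmetric $d$) that satisfies $\alpha$-perturbation resilience, with optimal cost $r^*$. Let $C\subseteq S$ be a set of $k$ centers that is an $\alpha$-approximation, i.e., for every $p\in S$ there exists $c\in C$ with $d(c,p)\le \alpha r^*$. Then the Voronoi partition induced by $C$ (under $d$) is the optimal clustering $\mathcal{OPT}$.
   Context: A $k$-center instance $(S,d)$ consists of a finite set $S$ of $n$ points, an integer $k$, and a distance function $d: S \times S \to \mathbb{R}_{\ge 0}$ with $d(p,p)=0$ satisfying the triangle inequality; $d$ need not be symmetric. For a set of $k$ distinct centers $\{c_1,\dots,c_k\}\subseteq S$, its Voronoi partition assigns each point $p$ to a center minimizing $d(c_i,p)$; its cost is $\max_{p\in S}\min_i d(c_i,p)$. $\mathcal{OPT}=\{C_1,\dots,C_k\}$ denotes the Voronoi partition of an optimal set of centers, and $r^*$ the optimal cost. For $\alpha\ge1$, an $\alpha$-perturbation of $d$ is any $d':S\times S\to\mathbb{R}_{\ge0}$ (not necessarily symmetric or satisfying the triangle inequality) with $d(p,q)\le d'(p,q)\le\alpha d(p,q)$ for all $p,q$. The instance satisfies $\alpha$-perturbation resilience if for every $\alpha$-perturbation $d'$ of $d$, the optimal $k$-center clustering under $d'$ (the Voronoi partition under $d'$ of an optimal set of $k$ centers for $d'$) is unique and equal to $\mathcal{OPT}$.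
   Formalization: The distance function $d$, the factor $\alpha$ and the optimal cost $r^*$ take rational values rather than real ones, and the perturbations $d'$ in the resilience hypothesis are likewise taken in ℚ. -}

module Defs where

open import Data.Nat using (ℕ)
open import Data.Fin using (Fin)
open import Data.Product using (_×_; ∃)
open import Data.Rational using (ℚ; _≤_; _+_; _*_; 0ℚ; 1ℚ)
open import Relation.Binary.PropositionalEquality using (_≡_)
open import Function.Definitions using (Injective)

Dist : ℕ → Set
Dist n = Fin n → Fin n → ℚ

IsAsymMetric : {n : ℕ} → Dist n → Set
IsAsymMetric {n} d =
  (∀ (p q : Fin n) → 0ℚ ≤ d p q) ×
  (∀ (p : Fin n) → d p p ≡ 0ℚ) ×
  (∀ (p q r : Fin n) → d p r ≤ d p q + d q r)

Centers : ℕ → ℕ → Set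
Centers k n = Fin k → Fin n

Distinct : {k n : ℕ} → Centers k n → Set
Distinct c = Injective _≡_ _≡_ c

Covers : {k n : ℕ} → Dist n → Centers k n → ℚ → Set
Covers {k} {n} d c r = ∀ (p : Fin n) → ∃ λ (i : Fin k) → d (c i) p ≤ r

OptimalCenters : {k n : ℕ} → Dist n → Centers k n → ℚ → Set
OptimalCenters {k} {n} d c r =
  Distinct c × Covers d c r ×
  (∀ (c' : Centers k n) (r' : ℚ) → Distinct c' → Covers d c' r' → r ≤ r')

-- A clustering is a labelling of points by cluster indices Fin k.
-- f is a Voronoi partition of c under d: each point is assigned to a center
-- minimizing d(c_i, p) (any tie-breaking).
IsVoronoi : {k n : ℕ} → Dist n → Centers k n → (Fin n → Fin k) → Set
IsVoronoi {k} {n} d c f = ∀ (p : Fin n) (j : Fin k) → d (c (f p)) p ≤ d (c j) p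

SamePartition : {k n : ℕ} → (Fin n → Fin k) → (Fin n → Fin k) → Set
SamePartition {k} {n} f g =
  ∀ (p q : Fin n) → (f p ≡ f q → g p ≡ g q) × (g p ≡ g q → f p ≡ f q)

IsPerturbation : {n : ℕ} → ℚ → Dist n → Dist n → Set
IsPerturbation {n} α d d' = ∀ (p q : Fin n) → (d p q ≤ d' p q) × (d' p q ≤ α * d p q)

PerturbationResilient : {k n : ℕ} → ℚ → Dist n → (Fin n → Fin k) → Set
PerturbationResilient {k} {n} α d opt =
  ∀ (d' : Dist n) → IsPerturbation α d d' →
  ∀ (c' : Centers k n) (r' : ℚ) → OptimalCenters d' c' r' →
  ∀ (f : Fin n → Fin k) → IsVoronoi d' c' f → SamePartition f opt

{-# OPTIONS --safe #-}
-- Perturb d into d' = max(d, min(α r*, α d)): every distance is stretched by α,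
-- but never beyond α r*.  Distances ≤ r* become exactly α times longer, so a
-- d'-cover of radius below α r* would shrink to a d-cover of radius below r*;
-- hence the optimal d'-cost is α r*, and C, which covers within α r* under d,
-- still covers within α r* under d'.  The stretching is monotone, so the
-- d-Voronoi partition of C is also a d'-Voronoi partition of an optimal
-- d'-solution, and resilience forces it to be OPT.
module Submission where

open import Defs
open import Data.Nat using (ℕ)
open import Data.Fin using (Fin)
open import Data.Rational using (ℚ; _≤_; _*_; 1ℚ)
open import Data.Rational as ℚ using (_<_; _⊓_; _⊔_; 0ℚ; 1/_; Positive; NonNegative; NonZero)
open import Data.Rational.Properties
open import Data.Product using (_,_)
open import Data.Sum using (inj₁; inj₂)
open import Relation.Nullary using (contradiction)
open import Relation.Binary.PropositionalEquality using (_≡_; refl; sym; cong; subst; module ≡-Reasoning)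

private
  variable
    k n : ℕ

p⊓q≤r∧r<p⇒q≤r : ∀ {p q r} → p ⊓ q ≤ r → r < p → q ≤ r
p⊓q≤r∧r<p⇒q≤r {p} {q} {r} p⊓q≤r r<p with ≤-total p q
... | inj₁ p≤q = contradiction (<-≤-trans r<p (subst (_≤ r) (p≤q⇒p⊓q≡p p≤q) p⊓q≤r)) (<-irrefl refl)
... | inj₂ q≤p = subst (_≤ r) (p≥q⇒p⊓q≡q q≤p) p⊓q≤r

IsVoronoi-mono : ∀ {h : ℚ → ℚ} {d : Dist n} {c : Centers k n} {f : Fin n → Fin k} →
                 (∀ {s t} → s ≤ t → h s ≤ h t) →
                 IsVoronoi d c f → IsVoronoi (λ p q → h (d p q)) c f
IsVoronoi-mono h-mono vor p j = h-mono (vor p j)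

stretchCapped : ℚ → ℚ → ℚ → ℚ
stretchCapped α A t = (A ⊓ (α * t)) ⊔ t

stretch : ℚ → ℚ → Dist n → Dist n
stretch α A d p q = stretchCapped α A (d p q)

stretchCapped-≤-cap : ∀ α A {t} → t ≤ A → stretchCapped α A t ≤ A
stretchCapped-≤-cap α A t≤A = ⊔-lub (p⊓q≤p A _) t≤A

Covers-stretch : ∀ α A {d : Dist n} {c : Centers k n} → Covers d c A → Covers (stretch α A d) c A
Covers-stretch α A cov p with cov p
... | i , d[ci,p]≤A = i , stretchCapped-≤-cap α A d[ci,p]≤A

module _ {α : ℚ} (1≤α : 1ℚ ≤ α) where

  private instance
    α-positive : Positive α
    α-positive = ℚ.positive (<-≤-trans (positive⁻¹ 1ℚ) 1≤α)
    α-nonNegative : NonNegative α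
    α-nonNegative = pos⇒nonNeg α
    α-nonZero : NonZero α
    α-nonZero = pos⇒nonZero α

  t≤α*t : ∀ {t} → 0ℚ ≤ t → t ≤ α * t
  t≤α*t {t} 0≤t = subst (_≤ α * t) (*-identityˡ t) (*-monoʳ-≤-nonNeg t {{ℚ.nonNegative 0≤t}} 1≤α)

  α*[1/α*r]≡r : ∀ r → α * ((1/ α) * r) ≡ r
  α*[1/α*r]≡r r = begin
    α * ((1/ α) * r)  ≡⟨ *-assoc α (1/ α) r ⟨
    (α * (1/ α)) * r  ≡⟨ cong (_* r) (*-inverseʳ α) ⟩
    1ℚ * r            ≡⟨ *-identityˡ r ⟩
    r                 ∎
    where open ≡-Reasoning

  stretchCapped-mono : ∀ A {s t} → s ≤ t → stretchCapped α A s ≤ stretchCapped α A t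
  stretchCapped-mono A s≤t = ⊔-mono-≤ (⊓-monoʳ-≤ A (*-monoˡ-≤-nonNeg α s≤t)) s≤t

  stretchCapped-below-cap : ∀ A {t r} → stretchCapped α A t ≤ r → r < A → α * t ≤ r
  stretchCapped-below-cap A {t} s≤r = p⊓q≤r∧r<p⇒q≤r (p⊔q≤r⇒p≤r (A ⊓ (α * t)) t s≤r)

  stretch-isPerturbation : ∀ A {d : Dist n} → (∀ p q → 0ℚ ≤ d p q) → IsPerturbation α d (stretch α A d)
  stretch-isPerturbation A {d} d≥0 p q =
    p≤q⊔p (A ⊓ (α * d p q)) (d p q) , ⊔-lub (p⊓q≤q A (α * d p q)) (t≤α*t (d≥0 p q))

  Covers-unstretch : ∀ A {d : Dist n} {c : Centers k n} {r} → r < A →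
                     Covers (stretch α A d) c r → Covers d c ((1/ α) * r)
  Covers-unstretch A {d} {c} {r} r<A cov p with cov p
  ... | i , s≤r = i , *-cancelˡ-≤-pos α (subst (α * d (c i) p ≤_) (sym (α*[1/α*r]≡r r))
                                                (stretchCapped-below-cap A s≤r r<A))

  stretch-optimal : ∀ {d : Dist n} {c* C : Centers k n} {r*} → OptimalCenters d c* r* →
                    Distinct C → Covers d C (α * r*) →
                    OptimalCenters (stretch α (α * r*) d) C (α * r*)
  stretch-optimal {d = d} {C = C} {r* = r*} (_ , _ , r*-minimal) C-distinct C-covers =
    C-distinct , Covers-stretch α (α * r*) {d} {C} C-covers , αr*-minimal
    where
    αr*-minimal : ∀ c' r' → Distinct c' → Covers (stretch α (α * r*) d) c' r' → α * r* ≤ r'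
    αr*-minimal c' r' c'-distinct c'-covers = ≮⇒≥ λ r'<αr* →
      let r*≤r'/α = r*-minimal c' _ c'-distinct (Covers-unstretch (α * r*) {d} {c'} r'<αr* c'-covers)
          αr*≤r'  = subst (α * r* ≤_) (α*[1/α*r]≡r r') (*-monoˡ-≤-nonNeg α r*≤r'/α)
      in <-irrefl refl (<-≤-trans r'<αr* αr*≤r')

theorem1 : (n k : ℕ) (d : Dist n) → IsAsymMetric d →
           (α : ℚ) → 1ℚ ≤ α →
           (cstar : Centers k n) (rstar : ℚ) → OptimalCenters d cstar rstar →
           (opt : Fin n → Fin k) → IsVoronoi d cstar opt →
           PerturbationResilient α d opt →
           (C : Centers k n) → Distinct C → Covers d C (α * rstar) →
           (f : Fin n → Fin k) → IsVoronoi d C f →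
           SamePartition f opt
theorem1 n k d (d≥0 , _) α 1≤α cstar rstar cstar-optimal opt _ resilient C C-distinct C-covers f f-voronoi =
  resilient (stretch α A d) (stretch-isPerturbation 1≤α A d≥0)
            C A (stretch-optimal 1≤α {d = d} {C = C} cstar-optimal C-distinct C-covers)
            f (IsVoronoi-mono {d = d} {c = C} (stretchCapped-mono 1≤α A) f-voronoi)
  where
  A : ℚ
  A = α * rstar
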